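{- Let $A$ be a non-empty set, $I$ a non-empty index set, $\mathcal{A}=(A,I,V_i)$ a fuzzy relational system, $E$ a fuzzy equivalence on $A$, and $\mathcal{A}/E=(A/E,I,V_i^{A/E})$ the quotient fuzzy relational system. Then the fuzzy relation $E^\natural\in\mathcal{R}(A,A/E)$ defined by $E^\natural(a_1,E_{a_2})=E(a_1,a_2)$ for all $a_1,a_2\in A$ is a uniform fuzzy relation whose kernel is $E$. Moreover, $E^\natural$ is a solution both to $WL^{2\text{ - }1}(A,A/E,I,V_i,V_i^{A/E})$ and to $WL^{2\text{ - }2}(A,A/E,I,V_i,V_i^{A/E})$, i.e. $(E^\natural)^{ -1}\circ V_i\le V_i^{A/E}\circ(E^\natural)^{ -1}$ and $V_i\circ E^\natural\le E^\natural\circ V_i^{A/E}$ for all $i\in I$.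
   Context: $\mathcal{L}=(L,\wedge,\vee,\otimes,\to,0,1)$ is a complete residuated lattice; $x\leftrightarrow y=(x\to y)\wedge(y\to x)$. $\mathcal{R}(A,B)$: fuzzy relations $A\times B\to L$; $\mathcal{R}(A)=\mathcal{R}(A,A)$; $R^{ -1}(b,a)=R(a,b)$; $(R\circ S)(a,c)=\bigvee_b R(a,b)\otimes S(b,c)$. A fuzzy equivalence on $A$ is $E\in\mathcal{R}(A)$ with $E(a,a)=1$, $E(a,b)=E(b,a)$, $E(a,b)\otimes E(b,c)\le E(a,c)$. For $a\in A$, $E_a$ is the fuzzy subset $x\mapsto E(a,x)$, and $A/E=\{E_a:a\in A\}$. A fuzzy relational system is $\mathcal{A}=(A,I,V_i)$ with $\{V_i\}_{i\in I}\subseteq\mathcal{R}(A)$. Its quotient by $E$ is $\mathcal{A}/E=(A/E,I,V_i^{A/E})$ where $V_i^{A/E}(E_{a_1},E_{a_2})=(E\circ V_i\circ E)(a_1,a_2)$ (well defined). Kernel and co-kernel of $R\in\mathcal{R}(A,B)$: $E_A^R(a_1,a_2)=\bigwedge_{b}(R(a_1,b)\leftrightarrow R(a_2,b))$, $E_B^R(b_1,b_2)=\bigwedge_a(R(a,b_1)\leftrightarrow R(a,b_2))$. $R$ is a partial fuzzy function if $R(a_1,b)\otimes E_A^R(a_1,a_2)\le R(a_2,b)$, $R(a,b_1)\otimes E_B^R(b_1,b_2)\le R(a,b_2)$ and $R(a,b_1)\otimes R(a,b_2)\le E_B^R(b_1,b_2)$ for all arguments. $R$ is a uniform fuzzy relation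 if it is a partial fuzzy function such that for every $a\in A$ some $b$ has $R(a,b)=1$ and for every $b\in B$ some $a$ has $R(a,b)=1$. With unknown $U\in\mathcal{R}(A,A/E)$: $WL^{2\text{ - }1}(A,A/E,I,V_i,V_i^{A/E})$ is $U^{ -1}\circ V_i\le V_i^{A/E}\circ U^{ -1}$ ($i\in I$); $WL^{2\text{ - }2}(A,A/E,I,V_i,V_i^{A/E})$ is $V_i\circ U\le U\circ V_i^{A/E}$ ($i\in I$). -}

module Defs where

open import Level using (Level; 0ℓ) renaming (suc to lsuc)
open import Data.Product using (Σ; Σ-syntax; ∃; _×_; _,_; proj₁; proj₂)
open import Relation.Binary.PropositionalEquality using (_≡_)

record CRL : Set₁ where
  infix  4 _≤_
  infixr 7 _⊗_
  infixr 6 _∧_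
  infixr 5 _⇔_
  infixr 6 _∨_
  infixr 5 _⇒_
  field
    Carrier : Set
    _≤_     : Carrier → Carrier → Set
    ≤-refl    : ∀ {x} → x ≤ x
    ≤-trans   : ∀ {x y z} → x ≤ y → y ≤ z → x ≤ z
    ≤-antisym : ∀ {x y} → x ≤ y → y ≤ x → x ≡ y
    _∧_ : Carrier → Carrier → Carrier
    _∨_ : Carrier → Carrier → Carrier
    ∧-lb₁ : ∀ x y → x ∧ y ≤ x
    ∧-lb₂ : ∀ x y → x ∧ y ≤ y
    ∧-glb : ∀ {x y z} → z ≤ x → z ≤ y → z ≤ x ∧ y
    ∨-ub₁ : ∀ x y → x ≤ x ∨ y
    ∨-ub₂ : ∀ x y → y ≤ x ∨ y
    ∨-lub : ∀ {x y z} → x ≤ z → y ≤ z → x ∨ y ≤ z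
    ⋁ : {X : Set} → (X → Carrier) → Carrier
    ⋀ : {X : Set} → (X → Carrier) → Carrier
    ⋁-ub  : {X : Set} (f : X → Carrier) (x : X) → f x ≤ ⋁ f
    ⋁-lub : {X : Set} (f : X → Carrier) {z : Carrier} → (∀ x → f x ≤ z) → ⋁ f ≤ z
    ⋀-lb  : {X : Set} (f : X → Carrier) (x : X) → ⋀ f ≤ f x
    ⋀-glb : {X : Set} (f : X → Carrier) {z : Carrier} → (∀ x → z ≤ f x) → z ≤ ⋀ f
    𝟘 : Carrier
    𝟙 : Carrier
    𝟘-min : ∀ x → 𝟘 ≤ x
    𝟙-max : ∀ x → x ≤ 𝟙
    _⊗_ : Carrier → Carrier → Carrier
    ⊗-assoc : ∀ x y z → (x ⊗ y) ⊗ z ≡ x ⊗ (y ⊗ z)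
    ⊗-comm  : ∀ x y → x ⊗ y ≡ y ⊗ x
    ⊗-idˡ   : ∀ x → 𝟙 ⊗ x ≡ x
    _⇒_ : Carrier → Carrier → Carrier
    adj₁ : ∀ {x y z} → x ⊗ y ≤ z → x ≤ y ⇒ z
    adj₂ : ∀ {x y z} → x ≤ y ⇒ z → x ⊗ y ≤ z

  _⇔_ : Carrier → Carrier → Carrier
  x ⇔ y = (x ⇒ y) ∧ (y ⇒ x)

module Fuzzy (𝓛 : CRL) where
  open CRL 𝓛

  L : Set
  L = Carrier

  FRel : Set → Set → Set
  FRel A B = A → B → L

  _⁻¹ : {A B : Set} → FRel A B → FRel B A
  (R ⁻¹) b a = R a b

  _∘ʳ_ : {A B C : Set} → FRel A B → FRel B C → FRel A C
  (R ∘ʳ S) a c = ⋁ (λ b → R a b ⊗ S b c)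

  _⊑_ : {A B : Set} → FRel A B → FRel A B → Set
  R ⊑ S = ∀ a b → R a b ≤ S a b

  record IsFuzzyEquivalence {A : Set} (E : FRel A A) : Set where
    field
      refl  : ∀ a → E a a ≡ 𝟙
      sym   : ∀ a b → E a b ≡ E b a
      trans : ∀ a b c → E a b ⊗ E b c ≤ E a c

  kernel : {A B : Set} → FRel A B → FRel A A
  kernel R a₁ a₂ = ⋀ (λ b → R a₁ b ⇔ R a₂ b)

  cokernel : {A B : Set} → FRel A B → FRel B B
  cokernel R b₁ b₂ = ⋀ (λ a → R a b₁ ⇔ R a b₂)

  record IsPartialFuzzyFunction {A B : Set} (R : FRel A B) : Set where
    field
      ext-A : ∀ a₁ a₂ b → R a₁ b ⊗ kernel R a₁ a₂ ≤ R a₂ b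
      ext-B : ∀ a b₁ b₂ → R a b₁ ⊗ cokernel R b₁ b₂ ≤ R a b₂
      func  : ∀ a b₁ b₂ → R a b₁ ⊗ R a b₂ ≤ cokernel R b₁ b₂

  record IsUniform {A B : Set} (R : FRel A B) : Set where
    field
      partial    : IsPartialFuzzyFunction R
      total      : ∀ a → Σ[ b ∈ B ] R a b ≡ 𝟙
      surjective : ∀ b → Σ[ a ∈ A ] R a b ≡ 𝟙

  -- The quotient set A/E = { E_a : a ∈ A }, represented as the type of fuzzy
  -- subsets f : A → L together with a witness a with f ≡ E_a.
  module Quotient {A : Set} (E : FRel A A) where

    Eclass : A → (A → L)
    Eclass a x = E a x

    A/E : Set
    A/E = Σ[ f ∈ (A → L) ] Σ[ a ∈ A ] f ≡ Eclass a

    rep : A/E → A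
    rep (_ , a , _) = a

    quotRel : FRel A A → FRel A/E A/E
    quotRel V c₁ c₂ = ((E ∘ʳ V) ∘ʳ E) (rep c₁) (rep c₂)

    natural : FRel A A/E
    natural a₁ c = E a₁ (rep c)

  WL2-1 : {A B I : Set} → (I → FRel A A) → (I → FRel B B) → FRel A B → Set
  WL2-1 V W U = ∀ i → ((U ⁻¹) ∘ʳ V i) ⊑ (W i ∘ʳ (U ⁻¹))

  WL2-2 : {A B I : Set} → (I → FRel A A) → (I → FRel B B) → FRel A B → Set
  WL2-2 V W U = ∀ i → (V i ∘ʳ U) ⊑ (U ∘ʳ W i)

module Submission where

open import Defs
open import Data.Product using (_×_; _,_)
open import Relation.Binary.PropositionalEquality as ≡ using (_≡_)

module ResiduatedLattice (𝓛 : CRL) where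
  open CRL 𝓛

  ≡⇒≤ : ∀ {x y} → x ≡ y → x ≤ y
  ≡⇒≤ ≡.refl = ≤-refl

  ⊗-idʳ : ∀ x → x ⊗ 𝟙 ≡ x
  ⊗-idʳ x = ≡.trans (⊗-comm x 𝟙) (⊗-idˡ x)

  -- ⊗ is monotone in each argument (it is a left adjoint).
  ⊗-monoˡ : ∀ {x y} z → x ≤ y → x ⊗ z ≤ y ⊗ z
  ⊗-monoˡ z x≤y = adj₂ (≤-trans x≤y (adj₁ ≤-refl))

  ⊗-monoʳ : ∀ {x y} z → x ≤ y → z ⊗ x ≤ z ⊗ y
  ⊗-monoʳ {x} {y} z x≤y =
    ≤-trans (≡⇒≤ (⊗-comm z x)) (≤-trans (⊗-monoˡ z x≤y) (≡⇒≤ (⊗-comm y z)))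

  modus-ponens : ∀ x y → x ⊗ (x ⇒ y) ≤ y
  modus-ponens x y = ≤-trans (≡⇒≤ (⊗-comm x (x ⇒ y))) (adj₂ ≤-refl)

  ⇔-intro : ∀ {x y z} → z ⊗ x ≤ y → z ⊗ y ≤ x → z ≤ x ⇔ y
  ⇔-intro zx≤y zy≤x = ∧-glb (adj₁ zx≤y) (adj₁ zy≤x)

  ⇔-𝟙 : ∀ {x y} → y ≡ 𝟙 → x ⇔ y ≤ x
  ⇔-𝟙 {x} ≡.refl =
    ≤-trans (∧-lb₂ _ _) (≤-trans (≡⇒≤ (≡.sym (⊗-idʳ (𝟙 ⇒ x)))) (adj₂ ≤-refl))

module FuzzyRelations (𝓛 : CRL) where
  open CRL 𝓛
  open Fuzzy 𝓛
  open ResiduatedLattice 𝓛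

  -- Every fuzzy relation is extensional with respect to its kernel and its
  -- co-kernel, since these are meets of the relevant biresidua.
  kernel-extensional : ∀ {A B} (R : FRel A B) a₁ a₂ b →
    R a₁ b ⊗ kernel R a₁ a₂ ≤ R a₂ b
  kernel-extensional R a₁ a₂ b =
    ≤-trans (⊗-monoʳ (R a₁ b) (≤-trans (⋀-lb _ b) (∧-lb₁ _ _))) (modus-ponens _ _)

  cokernel-extensional : ∀ {A B} (R : FRel A B) a b₁ b₂ →
    R a b₁ ⊗ cokernel R b₁ b₂ ≤ R a b₂
  cokernel-extensional R a b₁ b₂ =
    ≤-trans (⊗-monoʳ (R a b₁) (≤-trans (⋀-lb _ a) (∧-lb₁ _ _))) (modus-ponens _ _)

  partial-fuzzy-function : ∀ {A B} (R : FRel A B) →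
    (∀ a b₁ b₂ → R a b₁ ⊗ R a b₂ ≤ cokernel R b₁ b₂) →
    IsPartialFuzzyFunction R
  partial-fuzzy-function R functional = record
    { ext-A = kernel-extensional R
    ; ext-B = cokernel-extensional R
    ; func  = functional
    }

  ∘-term : ∀ {A B C} (R : FRel A B) (S : FRel B C) a b c →
    R a b ⊗ S b c ≤ (R ∘ʳ S) a c
  ∘-term R S a b c = ⋁-ub (λ b′ → R a b′ ⊗ S b′ c) b

  ∘-unitʳ : ∀ {A B C} (R : FRel A B) (S : FRel B C) {a b c} →
    S b c ≡ 𝟙 → R a b ≤ (R ∘ʳ S) a c
  ∘-unitʳ R S {a} {b} {c} Sbc≡𝟙 =
    ≤-trans (≡⇒≤ (≡.sym (≡.trans (≡.cong (R a b ⊗_) Sbc≡𝟙) (⊗-idʳ (R a b)))))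
            (∘-term R S a b c)

  ∘-unitˡ : ∀ {A B C} (R : FRel A B) (S : FRel B C) {a b c} →
    R a b ≡ 𝟙 → S b c ≤ (R ∘ʳ S) a c
  ∘-unitˡ R S {a} {b} {c} Rab≡𝟙 =
    ≤-trans (≡⇒≤ (≡.sym (≡.trans (≡.cong (_⊗ S b c) Rab≡𝟙) (⊗-idˡ (S b c)))))
            (∘-term R S a b c)

module NaturalRelation (𝓛 : CRL) {A : Set} (E : Fuzzy.FRel 𝓛 A A)
                       (isEquivalence : Fuzzy.IsFuzzyEquivalence 𝓛 E) where
  open CRL 𝓛
  open Fuzzy 𝓛
  open ResiduatedLattice 𝓛
  open FuzzyRelations 𝓛
  open IsFuzzyEquivalence isEquivalence
    renaming (refl to E-refl; sym to E-sym; trans to E-trans)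
  open Quotient E

  [_] : A → A/E
  [ a ] = Eclass a , a , ≡.refl

  E-common : ∀ a b c → E a b ⊗ E a c ≤ E b c
  E-common a b c = ≤-trans (⊗-monoˡ (E a c) (≡⇒≤ (E-sym a b))) (E-trans b a c)

  E-congˡ : ∀ a₁ a₂ b → E a₁ a₂ ≤ E a₁ b ⇔ E a₂ b
  E-congˡ a₁ a₂ b = ⇔-intro (E-common a₁ a₂ b) (E-trans a₁ a₂ b)

  E-congʳ : ∀ b₁ b₂ x → E b₁ b₂ ≤ E x b₁ ⇔ E x b₂
  E-congʳ b₁ b₂ x = ⇔-intro
    (≤-trans (≡⇒≤ (⊗-comm _ _)) (E-trans x b₁ b₂))
    (≤-trans (⊗-monoˡ (E x b₂) (≡⇒≤ (E-sym b₁ b₂)))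
             (≤-trans (≡⇒≤ (⊗-comm _ _)) (E-trans x b₂ b₁)))

  natural-[] : ∀ a → natural a [ a ] ≡ 𝟙
  natural-[] = E-refl

  kernel-natural : ∀ a₁ a₂ → kernel natural a₁ a₂ ≡ E a₁ a₂
  kernel-natural a₁ a₂ = ≤-antisym
    (≤-trans (⋀-lb _ [ a₂ ]) (⇔-𝟙 (E-refl a₂)))
    (⋀-glb _ (λ c → E-congˡ a₁ a₂ (rep c)))

  natural-functional : ∀ a c₁ c₂ →
    natural a c₁ ⊗ natural a c₂ ≤ cokernel natural c₁ c₂
  natural-functional a c₁ c₂ =
    ⋀-glb _ (λ x → ≤-trans (E-common a (rep c₁) (rep c₂)) (E-congʳ (rep c₁) (rep c₂) x))

  natural-uniform : IsUniform natural
  natural-uniform = record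
    { partial    = partial-fuzzy-function natural natural-functional
    ; total      = λ a → [ a ] , natural-[] a
    ; surjective = λ c → rep c , E-refl (rep c)
    }

  -- WL²⁻¹: the summand at b is carried into (E ∘ V ∘ E)(rep c, a), which is
  -- the value of V^{A/E} at (c, [a]), and [a] is a 𝟙-link back to a.
  natural-WL2-1 : ∀ (V : FRel A A) → ((natural ⁻¹) ∘ʳ V) ⊑ (quotRel V ∘ʳ (natural ⁻¹))
  natural-WL2-1 V c a = ⋁-lub (λ b → natural b c ⊗ V b a) λ b →
    ≤-trans (⊗-monoˡ (V b a) (≡⇒≤ (E-sym b (rep c))))
    (≤-trans (∘-term E V (rep c) b a)
    (≤-trans (∘-unitʳ (E ∘ʳ V) E (E-refl a))
             (∘-unitʳ (quotRel V) (natural ⁻¹) {c} {[ a ]} {a} (natural-[] a))))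

  -- WL²⁻²: the summand at b lies below (E ∘ V ∘ E)(a, rep c), the value of
  -- V^{A/E} at ([a], c), and a is 𝟙-linked to [a].
  natural-WL2-2 : ∀ (V : FRel A A) → (V ∘ʳ natural) ⊑ (natural ∘ʳ quotRel V)
  natural-WL2-2 V a c = ⋁-lub (λ b → V a b ⊗ natural b c) λ b →
    ≤-trans (⊗-monoˡ (E b (rep c)) (∘-unitˡ E V (E-refl a)))
    (≤-trans (∘-term (E ∘ʳ V) E a b (rep c))
             (∘-unitˡ natural (quotRel V) {a} {[ a ]} {c} (natural-[] a)))

theorem6p1 : (𝓛 : CRL) (A : Set) → A → (I : Set) → I →
    (V : I → Fuzzy.FRel 𝓛 A A) (E : Fuzzy.FRel 𝓛 A A) →
    Fuzzy.IsFuzzyEquivalence 𝓛 E →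
    Fuzzy.IsUniform 𝓛 (Fuzzy.Quotient.natural 𝓛 E)
    × (∀ a₁ a₂ → Fuzzy.kernel 𝓛 (Fuzzy.Quotient.natural 𝓛 E) a₁ a₂ ≡ E a₁ a₂)
    × Fuzzy.WL2-1 𝓛 V (λ i → Fuzzy.Quotient.quotRel 𝓛 E (V i)) (Fuzzy.Quotient.natural 𝓛 E)
    × Fuzzy.WL2-2 𝓛 V (λ i → Fuzzy.Quotient.quotRel 𝓛 E (V i)) (Fuzzy.Quotient.natural 𝓛 E)
theorem6p1 𝓛 _ _ _ _ V E isEquivalence =
    natural-uniform
  , kernel-natural
  , (λ i → natural-WL2-1 (V i))
  , (λ i → natural-WL2-2 (V i))
  where open NaturalRelation 𝓛 E isEquivalence
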